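{- Let $x,y,k$ be positive integers with $k\ge3$. Let $\overrightarrow{G}$ be a $\overrightarrow{C}_n$-factor of $\overrightarrow{C}_{(x:k)}$ and $\overrightarrow{H}$ a $\overrightarrow{C}_m$-factor of $\overrightarrow{C}_{(y:k)}$. Then $\overrightarrow{G}\otimes\overrightarrow{H}$ is a $\overrightarrow{C}_\ell$-factor of $\overrightarrow{C}_{(xy:k)}$, where $\ell=\frac{nm}{\gcd(n,m)}$.
   Context: For positive integers $v$ and $k\ge3$, $\overrightarrow{C}_{(v:k)}$ has vertex set $\{(g,i):0\le g\le v-1,\ i\in\mathbb{Z}_k\}$ and arcs $((g,i),(h,i+1))$ for all $g,h$, $i$. A $\overrightarrow{C}_\ell$-factor is a spanning subgraph each of whose components is a directed cycle of length $\ell$. For directed $k$-partite graphs $G,H$ (vertices $(g,i)$, $(h,i)$ with $i$ the part index), the partite product $G\otimes H$ has vertex set $\{(g,h,i):(g,i)\in V(G),(h,i)\in V(H)\}$ and an arc from $(g_1,h_1,i)$ to $(g_2,h_2,j)$ iff $((g_1,i),(g_2,j))\in E(G)$ and $((h_1,i),(h_2,j))\in E(H)$; thus $\overrightarrow{C}_{(x:k)}\otimes\overrightarrow{C}_{(y:k)}\cong\overrightarrow{C}_{(xy:k)}$. -}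

module Defs where

open import Data.Nat using (ℕ; suc)
open import Data.Nat.DivMod using (_%_; m%n<n)
open import Data.Fin using (Fin; toℕ; fromℕ<; remQuot)
open import Data.Product using (_×_; _,_; Σ; ∃)
open import Function.Definitions using (Injective)
open import Relation.Binary.PropositionalEquality using (_≡_)

Digraph : Set → Set₁
Digraph V = V → V → Set

sucMod : ∀ {ℓ} → Fin ℓ → Fin ℓ
sucMod {suc n} i = fromℕ< (m%n<n (suc (toℕ i)) (suc n))

-- C→_(v:k): vertices (g , i), g ∈ Fin v, i ∈ ℤ_k; arcs (g,i) → (h,i+1) for all g h i.
CC : (v k : ℕ) → Digraph (Fin v × Fin k)
CC v k (g , i) (h , j) = j ≡ sucMod i

Spanning : ∀ {V} → Digraph V → Digraph V → Set
Spanning D F = ∀ u w → F u w → D u w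

ComponentIsCycle : ∀ {V} → ℕ → Digraph V → V → Set
ComponentIsCycle {V} ℓ F v =
  Σ (Fin ℓ → V) λ c →
    Injective _≡_ _≡_ c
    × (∃ λ i → c i ≡ v)
    × (∀ i → F (c i) (c (sucMod i)))
    × (∀ i w → F (c i) w → w ≡ c (sucMod i))
    × (∀ i w → F w (c (sucMod i)) → w ≡ c i)

IsCycleFactor : ∀ {V} → ℕ → Digraph V → Digraph V → Set
IsCycleFactor ℓ D F = Spanning D F × (∀ v → ComponentIsCycle ℓ F v)

_⊗_ : ∀ {x y k} → Digraph (Fin x × Fin k) → Digraph (Fin y × Fin k)
      → Digraph ((Fin x × Fin y) × Fin k)
(G ⊗ H) ((g₁ , h₁) , i) ((g₂ , h₂) , j) = G (g₁ , i) (g₂ , j) × H (h₁ , i) (h₂ , j)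

-- G ⊗ H transported to the vertex set Fin (x * y) × Fin k of C→_(xy:k)
-- along the standard bijection Fin (x * y) ≅ Fin x × Fin y (remQuot).
⊗-on-xy : ∀ {x y k} → Digraph (Fin x × Fin k) → Digraph (Fin y × Fin k)
          → Digraph (Fin (x Data.Nat.* y) × Fin k)
⊗-on-xy {x} {y} G H (a , i) (b , j) = (G ⊗ H) (remQuot y a , i) (remQuot y b , j)

module Submission where

open import Defs
open import Data.Nat using (ℕ; zero; suc; _+_; _*_; _≤_; _<_; NonZero; >-nonZero⁻¹)
open import Data.Nat.Properties
open import Data.Nat.DivMod
open import Data.Nat.Divisibility using (_∣_; divides; ∣-trans; n∣m*n; >⇒∤)
open import Data.Nat.GCD using (gcd)
open import Data.Nat.LCM using (lcm; m∣lcm[m,n]; n∣lcm[m,n]; lcm-least; gcd*lcm)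
open import Data.Fin as Fin using (Fin; toℕ; combine; remQuot)
open import Data.Fin.Properties using (toℕ-fromℕ<; toℕ-injective; toℕ<n; remQuot-combine; combine-remQuot)
open import Data.Product using (Σ; _×_; _,_; proj₁; proj₂; map₁; uncurry)
open import Data.Sum using (inj₁; inj₂)
open import Function using (_∘_; _⇔_; mk⇔; Equivalence)
open import Function.Definitions using (StrictlyInverseˡ; StrictlyInverseʳ)
open import Relation.Binary.PropositionalEquality
open import Relation.Nullary using (contradiction)

-- The cycles of G through (g , i) and of H through (h , i) can be followed in
-- lockstep, since both advance the part index; this traces a closed walk of
-- G ⊗ H through ((g , h) , i) whose arcs are the only ones of G ⊗ H at its
-- vertices, because that holds in each factor. After d steps the walk is back
-- where it started iff n ∣ d and m ∣ d, i.e. iff lcm n m ∣ d, so it closes up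
-- into a cycle of length lcm n m.

toℕ-sucMod : ∀ {ℓ} .{{_ : NonZero ℓ}} (i : Fin ℓ) → toℕ (sucMod i) ≡ suc (toℕ i) % ℓ
toℕ-sucMod {suc _} i = toℕ-fromℕ< _

∣∧<⇒≡0 : ∀ {m n} → m ∣ n → n < m → n ≡ 0
∣∧<⇒≡0 {n = zero}  _   _   = refl
∣∧<⇒≡0 {n = suc _} m∣n n<m = contradiction m∣n (>⇒∤ n<m)

sucMod^ : ∀ {ℓ} → ℕ → Fin ℓ → Fin ℓ
sucMod^ zero    i = i
sucMod^ (suc t) i = sucMod (sucMod^ t i)

sucMod^-+ : ∀ {ℓ} s t (i : Fin ℓ) → sucMod^ (s + t) i ≡ sucMod^ s (sucMod^ t i)
sucMod^-+ zero    t i = refl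
sucMod^-+ (suc s) t i = cong sucMod (sucMod^-+ s t i)

[1+m%n]%n≡[1+m]%n : ∀ m n .{{_ : NonZero n}} → suc (m % n) % n ≡ suc m % n
[1+m%n]%n≡[1+m]%n m n = begin
  suc (m % n) % n                 ≡⟨ %-remove-+ʳ (suc (m % n)) (n∣m*n (m / n)) ⟨
  (suc (m % n) + m / n * n) % n   ≡⟨ cong (λ z → suc z % n) (m≡m%n+[m/n]*n m n) ⟨
  suc m % n                       ∎
  where open ≡-Reasoning

toℕ-sucMod^ : ∀ {n} t (i : Fin (suc n)) → toℕ (sucMod^ t i) ≡ (toℕ i + t) % suc n
toℕ-sucMod^ {n} zero i = begin
  toℕ i                  ≡⟨ m<n⇒m%n≡m (toℕ<n i) ⟨
  toℕ i % suc n          ≡⟨ cong (_% suc n) (+-identityʳ (toℕ i)) ⟨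
  (toℕ i + 0) % suc n    ∎
  where open ≡-Reasoning
toℕ-sucMod^ {n} (suc t) i = begin
  toℕ (sucMod (sucMod^ t i))       ≡⟨ toℕ-sucMod (sucMod^ t i) ⟩
  suc (toℕ (sucMod^ t i)) % suc n  ≡⟨ cong (λ z → suc z % suc n) (toℕ-sucMod^ t i) ⟩
  suc ((toℕ i + t) % suc n) % suc n ≡⟨ [1+m%n]%n≡[1+m]%n (toℕ i + t) (suc n) ⟩
  suc (toℕ i + t) % suc n          ≡⟨ cong (_% suc n) (+-suc (toℕ i) t) ⟨
  (toℕ i + suc t) % suc n          ∎
  where open ≡-Reasoning

sucMod^-fixed⇔ : ∀ {n} d (i : Fin (suc n)) → sucMod^ d i ≡ i ⇔ suc n ∣ d
sucMod^-fixed⇔ {n} d i = mk⇔ fixed⇒∣ ∣⇒fixed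
  where
  fixed⇒∣ : sucMod^ d i ≡ i → suc n ∣ d
  fixed⇒∣ e = divides q (+-cancelˡ-≡ (toℕ i) d (q * suc n) (begin
    toℕ i + d                           ≡⟨ m≡m%n+[m/n]*n (toℕ i + d) (suc n) ⟩
    (toℕ i + d) % suc n + q * suc n     ≡⟨ cong (_+ q * suc n) (trans (sym (toℕ-sucMod^ d i)) (cong toℕ e)) ⟩
    toℕ i + q * suc n                   ∎))
    where
    open ≡-Reasoning
    q = (toℕ i + d) / suc n
  ∣⇒fixed : suc n ∣ d → sucMod^ d i ≡ i
  ∣⇒fixed n∣d = toℕ-injective (begin
    toℕ (sucMod^ d i)     ≡⟨ toℕ-sucMod^ d i ⟩
    (toℕ i + d) % suc n   ≡⟨ %-remove-+ʳ (toℕ i) n∣d ⟩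
    toℕ i % suc n         ≡⟨ m<n⇒m%n≡m (toℕ<n i) ⟩
    toℕ i                 ∎)
    where open ≡-Reasoning

-- A cycle of length ℓ of F, unrolled into an infinite walk w 0 → w 1 → ⋯
record IsCyclicWalk {V : Set} (ℓ : ℕ) (F : Digraph V) (w : ℕ → V) : Set where
  field
    returns  : ∀ t d → w (d + t) ≡ w t ⇔ ℓ ∣ d
    arc      : ∀ t → F (w t) (w (suc t))
    only-out : ∀ t u → F (w t) u → u ≡ w (suc t)
    only-in  : ∀ t u → F u (w (suc t)) → u ≡ w t

componentIsCycle⇒NonZero : ∀ {V ℓ} {F : Digraph V} {v} → ComponentIsCycle ℓ F v → NonZero ℓ
componentIsCycle⇒NonZero {ℓ = suc _} _ = _
componentIsCycle⇒NonZero {ℓ = zero} (_ , _ , (() , _) , _)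

componentIsCycle⇒cyclicWalk : ∀ {V ℓ} {F : Digraph V} {v} → ComponentIsCycle ℓ F v
  → Σ (ℕ → V) λ w → IsCyclicWalk ℓ F w × w 0 ≡ v
componentIsCycle⇒cyclicWalk {ℓ = zero} (_ , _ , (() , _) , _)
componentIsCycle⇒cyclicWalk {ℓ = suc n} {F} (c , c-injective , (p , cp≡v) , arc , only-out , only-in) =
  w , walk , cp≡v
  where
  w : ℕ → _
  w t = c (sucMod^ t p)
  returns : ∀ t d → w (d + t) ≡ w t ⇔ suc n ∣ d
  returns t d = mk⇔
    (λ e → Equivalence.to (sucMod^-fixed⇔ d _) (trans (sym (sucMod^-+ d t p)) (c-injective e)))
    (λ n∣d → cong c (trans (sucMod^-+ d t p) (Equivalence.from (sucMod^-fixed⇔ d _) n∣d)))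
  walk : IsCyclicWalk (suc n) F w
  walk = record
    { returns  = returns
    ; arc      = λ t → arc (sucMod^ t p)
    ; only-out = λ t → only-out (sucMod^ t p)
    ; only-in  = λ t → only-in (sucMod^ t p)
    }

module _ {V : Set} {ℓ : ℕ} {F : Digraph V} {w : ℕ → V} (walk : IsCyclicWalk ℓ F w) where
  open IsCyclicWalk walk

  cyclicWalk-% : .{{_ : NonZero ℓ}} → ∀ t → w (t % ℓ) ≡ w t
  cyclicWalk-% t = begin
    w (t % ℓ)                  ≡⟨ Equivalence.from (returns (t % ℓ) (t / ℓ * ℓ)) (n∣m*n (t / ℓ)) ⟨
    w (t / ℓ * ℓ + t % ℓ)      ≡⟨ cong w (+-comm (t / ℓ * ℓ) (t % ℓ)) ⟩
    w (t % ℓ + t / ℓ * ℓ)      ≡⟨ cong w (m≡m%n+[m/n]*n t ℓ) ⟨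
    w t                        ∎
    where open ≡-Reasoning

  cyclicWalk-injective-≤ : ∀ {a b} → a ≤ b → b < ℓ → w a ≡ w b → a ≡ b
  cyclicWalk-injective-≤ {a} a≤b b<ℓ e with m≤n⇒∃[o]m+o≡n a≤b
  ... | d , refl = sym (trans (cong (a +_) d≡0) (+-identityʳ a))
    where
    d≡0 : d ≡ 0
    d≡0 = ∣∧<⇒≡0 (Equivalence.to (returns a d) (trans (cong w (+-comm d a)) (sym e)))
                 (≤-<-trans (m≤n+m d a) b<ℓ)

  cyclicWalk-injective : ∀ {a b} → a < ℓ → b < ℓ → w a ≡ w b → a ≡ b
  cyclicWalk-injective {a} {b} a<ℓ b<ℓ e with ≤-total a b
  ... | inj₁ a≤b = cyclicWalk-injective-≤ a≤b b<ℓ e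
  ... | inj₂ b≤a = sym (cyclicWalk-injective-≤ b≤a a<ℓ (sym e))

  cyclicWalk⇒componentIsCycle : .{{_ : NonZero ℓ}} → ComponentIsCycle ℓ F (w 0)
  cyclicWalk⇒componentIsCycle =
    c , c-injective , (Fin.fromℕ< (>-nonZero⁻¹ ℓ) , cong w (toℕ-fromℕ< _)) , c-arc , c-only-out , c-only-in
    where
    c : Fin ℓ → V
    c s = w (toℕ s)
    c-injective : ∀ {s s′} → c s ≡ c s′ → s ≡ s′
    c-injective e = toℕ-injective (cyclicWalk-injective (toℕ<n _) (toℕ<n _) e)
    c-sucMod : ∀ s → c (sucMod s) ≡ w (suc (toℕ s))
    c-sucMod s = trans (cong w (toℕ-sucMod s)) (cyclicWalk-% (suc (toℕ s)))
    c-arc : ∀ s → F (c s) (c (sucMod s))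
    c-arc s = subst (F (c s)) (sym (c-sucMod s)) (arc (toℕ s))
    c-only-out : ∀ s u → F (c s) u → u ≡ c (sucMod s)
    c-only-out s u f = trans (only-out (toℕ s) u f) (sym (c-sucMod s))
    c-only-in : ∀ s u → F u (c (sucMod s)) → u ≡ c s
    c-only-in s u f = only-in (toℕ s) u (subst (F u) (c-sucMod s) f)

componentIsCycle-transport : ∀ {V W : Set} {ℓ} {F : Digraph V} (φ : W → V) (ψ : V → W)
  → StrictlyInverseˡ _≡_ φ ψ → StrictlyInverseʳ _≡_ φ ψ
  → ∀ {w} → ComponentIsCycle ℓ F (φ w) → ComponentIsCycle ℓ (λ a b → F (φ a) (φ b)) w
componentIsCycle-transport {F = F} φ ψ φ∘ψ ψ∘φ {w} (c , c-injective , (p , cp≡φw) , arc , only-out , only-in) =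
  ψ ∘ c , (c-injective ∘ ψ-injective) , (p , trans (cong ψ cp≡φw) (ψ∘φ w)) , arc′ , only-out′ , only-in′
  where
  ψ-injective : ∀ {a b} → ψ a ≡ ψ b → a ≡ b
  ψ-injective {a} {b} e = trans (sym (φ∘ψ a)) (trans (cong φ e) (φ∘ψ b))
  arc′ : ∀ i → F (φ (ψ (c i))) (φ (ψ (c (sucMod i))))
  arc′ i = subst₂ F (sym (φ∘ψ _)) (sym (φ∘ψ _)) (arc i)
  only-out′ : ∀ i u → F (φ (ψ (c i))) (φ u) → u ≡ ψ (c (sucMod i))
  only-out′ i u f = trans (sym (ψ∘φ u)) (cong ψ (only-out i (φ u) (subst (λ z → F z (φ u)) (φ∘ψ (c i)) f)))
  only-in′ : ∀ i u → F (φ u) (φ (ψ (c (sucMod i)))) → u ≡ ψ (c i)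
  only-in′ i u f = trans (sym (ψ∘φ u)) (cong ψ (only-in i (φ u) (subst (F (φ u)) (φ∘ψ _) f)))

lcm-nonZero : ∀ m n .{{_ : NonZero m}} .{{_ : NonZero n}} → NonZero (lcm m n)
lcm-nonZero m n = m*n≢0⇒n≢0 (gcd m n) {{subst NonZero (sym (gcd*lcm m n)) (m*n≢0 m n)}}

module _ {x y k : ℕ} {G : Digraph (Fin x × Fin k)} {H : Digraph (Fin y × Fin k)}
         (G-spanning : Spanning (CC x k) G) (H-spanning : Spanning (CC y k) H) where

  _⊛_ : Fin x × Fin k → Fin y × Fin k → (Fin x × Fin y) × Fin k
  (g , i) ⊛ (h , _) = (g , h) , i

  left : (Fin x × Fin y) × Fin k → Fin x × Fin k
  left ((g , _) , i) = g , i

  right : (Fin x × Fin y) × Fin k → Fin y × Fin k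
  right ((_ , h) , i) = h , i

  right-⊛ : ∀ u v → proj₂ u ≡ proj₂ v → right (u ⊛ v) ≡ v
  right-⊛ u (h , _) u∼v = cong (h ,_) u∼v

  ⊗-cyclicWalk : ∀ {n m wG wH} → IsCyclicWalk n G wG → IsCyclicWalk m H wH
    → proj₂ (wG 0) ≡ proj₂ (wH 0) → IsCyclicWalk (lcm n m) (G ⊗ H) (λ t → wG t ⊛ wH t)
  ⊗-cyclicWalk {n} {m} {wG} {wH} walkG walkH aligned₀ = record
    { returns  = returns
    ; arc      = λ t → G.arc t , subst₂ H (sym (right-w≡wH t)) (sym (right-w≡wH (suc t))) (H.arc t)
    ; only-out = λ { t ((g , h) , j) (gArc , hArc) →
        cong₂ _⊛_ (G.only-out t _ gArc) (H.only-out t _ (subst (λ v → H v (h , j)) (right-w≡wH t) hArc)) }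
    ; only-in  = λ { t ((g , h) , j) (gArc , hArc) →
        cong₂ _⊛_ (G.only-in t _ gArc) (H.only-in t _ (subst (H (h , j)) (right-w≡wH (suc t)) hArc)) }
    }
    where
    module G = IsCyclicWalk walkG
    module H = IsCyclicWalk walkH
    aligned : ∀ t → proj₂ (wG t) ≡ proj₂ (wH t)
    aligned zero    = aligned₀
    aligned (suc t) = trans (G-spanning _ _ (G.arc t))
                            (trans (cong sucMod (aligned t)) (sym (H-spanning _ _ (H.arc t))))
    right-w≡wH : ∀ t → right (wG t ⊛ wH t) ≡ wH t
    right-w≡wH t = right-⊛ (wG t) (wH t) (aligned t)
    returns : ∀ t d → wG (d + t) ⊛ wH (d + t) ≡ wG t ⊛ wH t ⇔ lcm n m ∣ d
    returns t d = mk⇔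
      (λ e → lcm-least (Equivalence.to (G.returns t d) (cong left e))
                       (Equivalence.to (H.returns t d) (trans (sym (right-w≡wH (d + t))) (trans (cong right e) (right-w≡wH t)))))
      (λ l∣d → cong₂ _⊛_ (Equivalence.from (G.returns t d) (∣-trans (m∣lcm[m,n] n m) l∣d))
                         (Equivalence.from (H.returns t d) (∣-trans (n∣lcm[m,n] n m) l∣d)))

  ⊗-componentIsCycle : ∀ {n m u v} → ComponentIsCycle n G u → ComponentIsCycle m H v
    → proj₂ u ≡ proj₂ v → ComponentIsCycle (lcm n m) (G ⊗ H) (u ⊛ v)
  ⊗-componentIsCycle {n} {m} cycG cycH u∼v
    with wG , walkG , wG₀≡u ← componentIsCycle⇒cyclicWalk cycG
       | wH , walkH , wH₀≡v ← componentIsCycle⇒cyclicWalk cycH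
    = subst (ComponentIsCycle (lcm n m) (G ⊗ H)) (cong₂ _⊛_ wG₀≡u wH₀≡v)
        (cyclicWalk⇒componentIsCycle (⊗-cyclicWalk walkG walkH aligned₀) {{nonZero}})
    where
    aligned₀ : proj₂ (wG 0) ≡ proj₂ (wH 0)
    aligned₀ = trans (cong proj₂ wG₀≡u) (trans u∼v (sym (cong proj₂ wH₀≡v)))
    nonZero : NonZero (lcm n m)
    nonZero = lcm-nonZero n m {{componentIsCycle⇒NonZero {F = G} cycG}} {{componentIsCycle⇒NonZero {F = H} cycH}}

lemma4p3 : (x y k n m : ℕ) → 1 ≤ x → 1 ≤ y → 3 ≤ k
    → (G : Digraph (Fin x × Fin k)) → (H : Digraph (Fin y × Fin k))
    → IsCycleFactor n (CC x k) G → IsCycleFactor m (CC y k) H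
    → IsCycleFactor (lcm n m) (CC (x * y) k) (⊗-on-xy G H)
lemma4p3 x y k n m _ _ _ G H (G-spanning , G-cycles) (H-spanning , H-cycles) = spanning , cycles
  where
  spanning : Spanning (CC (x * y) k) (⊗-on-xy G H)
  spanning _ _ (gArc , _) = G-spanning _ _ gArc
  split : Fin (x * y) × Fin k → (Fin x × Fin y) × Fin k
  split = map₁ (remQuot y)
  join : (Fin x × Fin y) × Fin k → Fin (x * y) × Fin k
  join = map₁ (uncurry combine)
  cycles : ∀ v → ComponentIsCycle (lcm n m) (⊗-on-xy G H) v
  cycles (a , i) = componentIsCycle-transport {F = G ⊗ H} split join
    (λ { ((g , h) , i) → cong (_, i) (remQuot-combine g h) })
    (λ { (a , i) → cong (_, i) (combine-remQuot {x} y a) })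
    (⊗-componentIsCycle G-spanning H-spanning (G-cycles (g , i)) (H-cycles (h , i)) refl)
    where
    g : Fin x
    g = proj₁ (remQuot {x} y a)
    h : Fin y
    h = proj₂ (remQuot {x} y a)
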